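{- Let $\mathcal{R}=(r_1,\dots,r_\ell)$ with $\ell\ge1$ be a decreasing sequence of positive integers and let $0\le n\le m$ be integers. Define $\nu_1=m$, $\alpha_1=n$, $\beta_1=m-n$ and, for $1\le i\le \ell$, $\nu_{i+1}=\varepsilon_{r_i}(\nu_i)$, $\alpha_{i+1}=\varepsilon_{r_i}(\alpha_i)$, $\beta_{i+1}=\varepsilon_{r_i}(\beta_i)$. If $\nu_i=\alpha_i+\beta_i$ for all $1\le i\le \ell+1$, then $$\begin{Bmatrix}m\\ n\end{Bmatrix}_{\mathcal{R}}=\frac{\{m\}_{\mathcal{R}}!}{\{n\}_{\mathcal{R}}!\,\{m-n\}_{\mathcal{R}}!}$$ is a polynomial, i.e. lies in $\mathbb{Z}[s_1,s_2,\dots]$.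
   Context: Let $s_1,s_2,\dots$ be commuting indeterminates and $\mathbb{Z}[S]=\mathbb{Z}[s_1,s_2,\dots]$. The Lucas polynomials $\{m\}\in\mathbb{Z}[s_1,s_2]$ are defined by $\{0\}=0$, $\{1\}=1$, $\{m\}=s_1\{m-1\}+s_2\{m-2\}$ for $m\ge2$. For a positive integer $r$, $\phi_r:\mathbb{Z}[s_1,s_2]\to\mathbb{Z}[S]$ is the ring homomorphism with $\phi_r(s_1)=s_r$, $\phi_r(s_2)=s_{2r}$. Here $a\bmod r\in\{0,\dots,r-1\}$ is the remainder (also for negative $a$), and $\varepsilon_r(a)=((a-1)\bmod r)+1\in\{1,\dots,r\}$; in particular $\varepsilon_r(0)=r$. For a sequence $\mathcal{R}=(r_1,\dots,r_\ell)$ write $\mathcal{R}'=(r_2,\dots,r_\ell)$ and $\varnothing$ for the empty sequence. The $\mathcal{R}$-Lucas polynomials are defined for $m\ge1$ recursively by $\{m\}_\varnothing=s_1^{m-1}$ and, for $\ell\ge1$, $\{m\}_{\mathcal{R}}=\{\varepsilon_{r_1}(m)\}_{\mathcal{R}'}\cdot\phi_{r_1}\bigl(\{\lceil m/r_1\rceil\}\bigr)$. Factorials: $\{0\}_{\mathcal{R}}!=1$ and $\{m\}_{\mathcal{R}}!=\{m\}_{\mathcal{R}}\cdot\{m-1\}_{\mathcal{R}}!$ for $m\ge1$. The quotient is a priori a rational function in the $s_i$. -}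

module Defs where

open import Level using (0ℓ)
open import Algebra.Bundles using (CommutativeRing)
open import Data.Nat using (ℕ; zero; suc; _+_; _∸_; _<_; _>_; _%_; _/_)
open import Data.List using (List; []; _∷_)
open import Data.List.Relation.Unary.All using (All)
open import Data.List.Relation.Unary.Linked using (Linked)
open import Data.Product using (Σ; _×_)
open import Relation.Binary.PropositionalEquality using (_≡_)

-- Z[S] = Z[s₁, s₂, …]: polynomial expressions in the indeterminates,
-- with equality "equal in Z[S]" expressed through the universal property
-- of the free commutative ring: equal under every evaluation in every
-- commutative ring.  The constructor  var i  denotes  s_(i+1).

data Expr : Set where
  var  : ℕ → Expr
  zer  : Expr
  one  : Expr
  _⊕_  : Expr → Expr → Expr
  _⊗_  : Expr → Expr → Expr
  ⊝_   : Expr → Expr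

infixl 6 _⊕_
infixl 7 _⊗_

s : ℕ → Expr
s zero    = var zero   -- junk, never used
s (suc i) = var i

⟦_⟧ : Expr → (R : CommutativeRing 0ℓ 0ℓ) → (ℕ → CommutativeRing.Carrier R) →
      CommutativeRing.Carrier R
⟦ var i ⟧ R ρ = ρ i
⟦ zer ⟧ R ρ = CommutativeRing.0# R
⟦ one ⟧ R ρ = CommutativeRing.1# R
⟦ e ⊕ f ⟧ R ρ = CommutativeRing._+_ R (⟦ e ⟧ R ρ) (⟦ f ⟧ R ρ)
⟦ e ⊗ f ⟧ R ρ = CommutativeRing._*_ R (⟦ e ⟧ R ρ) (⟦ f ⟧ R ρ)
⟦ ⊝ e ⟧ R ρ = CommutativeRing.-_ R (⟦ e ⟧ R ρ)

_≈P_ : Expr → Expr → Set₁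
e ≈P f = (R : CommutativeRing 0ℓ 0ℓ) (ρ : ℕ → CommutativeRing.Carrier R) →
         CommutativeRing._≈_ R (⟦ e ⟧ R ρ) (⟦ f ⟧ R ρ)

_∣P_ : Expr → Expr → Set₁
a ∣P b = Σ Expr (λ q → (q ⊗ a) ≈P b)

_^P_ : Expr → ℕ → Expr
e ^P zero  = one
e ^P suc k = e ⊗ (e ^P k)

lucas : ℕ → Expr
lucas zero          = zer
lucas (suc zero)    = one
lucas (suc (suc m)) = s 1 ⊗ lucas (suc m) ⊕ s 2 ⊗ lucas m

subst : (ℕ → Expr) → Expr → Expr
subst σ (var i) = σ i
subst σ zer = zer
subst σ one = one
subst σ (e ⊕ f) = subst σ e ⊕ subst σ f
subst σ (e ⊗ f) = subst σ e ⊗ subst σ f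
subst σ (⊝ e) = ⊝ subst σ e

φ : ℕ → Expr → Expr
φ r = subst σ
  where
  σ : ℕ → Expr
  σ zero       = s r
  σ (suc zero) = s (r + r)
  σ (suc (suc i)) = var (suc (suc i))   -- irrelevant: only s₁,s₂ occur

ε : ℕ → ℕ → ℕ
ε zero    a       = zero           -- junk (r = 0 never used)
ε (suc k) zero    = suc k
ε (suc k) (suc a) = suc (a % suc k)

ceilDiv : ℕ → ℕ → ℕ
ceilDiv zero    m = zero           -- junk
ceilDiv (suc k) m = (m + k) / suc k

rlucas : List ℕ → ℕ → Expr
rlucas [] m      = s 1 ^P (m ∸ 1)
rlucas (r ∷ R) m = rlucas R (ε r m) ⊗ φ r (lucas (ceilDiv r m))

rfact : List ℕ → ℕ → Expr
rfact R zero    = one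
rfact R (suc m) = rlucas R (suc m) ⊗ rfact R m

Cond : List ℕ → ℕ → ℕ → ℕ → Set
Cond []      ν α β = ν ≡ α + β
Cond (r ∷ R) ν α β = (ν ≡ α + β) × Cond R (ε r ν) (ε r α) (ε r β)

DecreasingPos : List ℕ → Set
DecreasingPos R = Linked _>_ R × All (λ r → 0 < r) R

-- Write m = q r + t with 1 ≤ t ≤ r. Unwinding the definition, {m}_{r∷R}! factors as
-- ({t}_R! {r}_R!^q) · φ_r({q}!)^r φ_r({q+1})^t. For α = a r + e₁ and β = b r + e₂ the
-- condition ν = α + β one level down reads e₁ + e₂ = ε_r(α + β) ≤ r, so α + β = (a + b) r + (e₁ + e₂)
-- is of the same shape. The quotient then splits into a power of {r}_R! (which cancels), the
-- R-quotient for (e₁, e₂) (a polynomial by induction on R), and φ_r-images of ordinary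
-- Lucasnomials {a+b}! / ({a}! {b}!), which are polynomials by the Pascal-type recursion
-- {a+b+1} = {a+1}{b+1} + s₂{a}{b}. For R = ∅ all factorials are powers of s₁.

module Submission where

open import Defs
open import Data.Nat using (ℕ; _≤_; _∸_)
open import Data.List using (List; []; _∷_)

open import Level using (0ℓ) renaming (suc to lsuc)
open import Algebra.Bundles using (CommutativeRing; CommutativeSemiring)
import Data.Nat as ℕ
open import Data.Nat using (zero; suc; _%_; _/_; _<_)
import Data.Nat.Properties as ℕₚ
open ℕₚ using (m≤n⇒∃[o]m+o≡n)
open import Data.Nat.DivMod
  using (m≡m%n+[m/n]*n; m%n<n; %-remove-+ˡ; m<n⇒m%n≡m; /-congˡ; +-distrib-/-∣ʳ; m<n⇒m/n≡0; m*n/n≡m)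
open import Data.Nat.Divisibility using (n∣m*n)
open import Data.Nat.Tactic.RingSolver using (solve-∀)
open import Data.Product using (_,_)
open import Data.List.Relation.Unary.All using (All; _∷_)
import Relation.Binary.PropositionalEquality as ≡
open ≡ using (_≡_)

module CommutativeSemiringDivisibility {c ℓ} (S : CommutativeSemiring c ℓ) where
  open CommutativeSemiring S
  open import Algebra.Properties.CommutativeSemiring.Exp S
  open import Algebra.Properties.Semiring.Divisibility semiring
  open import Algebra.Properties.CommutativeSemigroup.Divisibility *-commutativeSemigroup
    using (∙-cong-∣)
  open import Algebra.Solver.Ring.NaturalCoefficients.Default S using (solve; _:=_; _:*_)
  open import Relation.Binary.Reasoning.Setoid setoid

  1^n≈1 : ∀ n → 1# ^ n ≈ 1#
  1^n≈1 zero    = refl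
  1^n≈1 (suc n) = trans (*-identityˡ _) (1^n≈1 n)

  x∣y⇒x^n∣y^n : ∀ {x y} n → x ∣ y → x ^ n ∣ y ^ n
  x∣y⇒x^n∣y^n zero    _   = ∣ʳ-refl
  x∣y⇒x^n∣y^n (suc n) x∣y = ∙-cong-∣ x∣y (x∣y⇒x^n∣y^n n x∣y)

  x∣y∧x∣z⇒x∣y+z : ∀ {x y z} → x ∣ y → x ∣ z → x ∣ y + z
  x∣y∧x∣z⇒x∣y+z (p , px≈y) (q , qx≈z) = p + q , trans (distribʳ _ p q) (+-cong px≈y qx≈z)

  x^n∣x^[m+n] : ∀ x m n → x ^ n ∣ x ^ (m ℕ.+ n)
  x^n∣x^[m+n] x m n = ∣ʳ-respʳ-≈ (sym (^-homo-* x m n)) (x∣ʳyx (x ^ n) (x ^ m))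

  ^-homo-*₃ : ∀ x l m n → x ^ (l ℕ.+ m ℕ.+ n) ≈ (x ^ l * x ^ m) * x ^ n
  ^-homo-*₃ x l m n = trans (^-homo-* x (l ℕ.+ m) n) (*-congʳ (^-homo-* x l m))

  ^-distrib-*₃ : ∀ x y z n → (x * y * z) ^ n ≈ (x ^ n * y ^ n) * z ^ n
  ^-distrib-*₃ x y z n = trans (^-distrib-* (x * y) z n) (*-congʳ (^-distrib-* x y n))

  block : (f L : ℕ → Carrier) → ℕ → ℕ → ℕ → Carrier
  block f L r q t = f q ^ r * L (suc q) ^ t

  module _ (f L : ℕ → Carrier) (f-suc : ∀ a → f (suc a) ≈ L (suc a) * f a)
           (f-∣ : ∀ a b → f a * f b ∣ f (a ℕ.+ b)) where

    block*block∣block : ∀ {r a b e₁ e₂} → e₁ ℕ.+ e₂ ≤ r →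
      block f L r a e₁ * block f L r b e₂ ∣ block f L r (a ℕ.+ b) (e₁ ℕ.+ e₂)
    -- With r = e₁ + e₂ + o both sides regroup into e₁-th, e₂-th and o-th powers that divide termwise.
    block*block∣block {a = a} {b} {e₁} {e₂} e₁+e₂≤r with o , ≡.refl ← m≤n⇒∃[o]m+o≡n e₁+e₂≤r =
      ∣ʳ-respˡ-≈ (sym split) (∣ʳ-respʳ-≈ (sym merge)
        (∙-cong-∣ (∙-cong-∣ (x∣y⇒x^n∣y^n e₁ (f-∣ (suc a) b)) (x∣y⇒x^n∣y^n e₂ fa*fsb∣fs[a+b]))
                  (x∣y⇒x^n∣y^n o (f-∣ a b))))
      where
      fa*fsb∣fs[a+b] : f a * f (suc b) ∣ f (suc (a ℕ.+ b))
      fa*fsb∣fs[a+b] = ≡.subst (λ n → f a * f (suc b) ∣ f n) (ℕₚ.+-suc a b) (f-∣ a (suc b))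
      x = f a ; y = f b ; X = L (suc a) ; Y = L (suc b) ; z = f (a ℕ.+ b) ; Z = L (suc (a ℕ.+ b))
      split : block f L (e₁ ℕ.+ e₂ ℕ.+ o) a e₁ * block f L (e₁ ℕ.+ e₂ ℕ.+ o) b e₂
            ≈ ((f (suc a) * y) ^ e₁ * (x * f (suc b)) ^ e₂) * (x * y) ^ o
      split = begin
        (x ^ (e₁ ℕ.+ e₂ ℕ.+ o) * X ^ e₁) * (y ^ (e₁ ℕ.+ e₂ ℕ.+ o) * Y ^ e₂)
          ≈⟨ *-cong (*-congʳ (^-homo-*₃ x e₁ e₂ o)) (*-congʳ (^-homo-*₃ y e₁ e₂ o)) ⟩
        (((x ^ e₁ * x ^ e₂) * x ^ o) * X ^ e₁) * (((y ^ e₁ * y ^ e₂) * y ^ o) * Y ^ e₂)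
          ≈⟨ solve 8 (λ x₁ x₂ x₃ y₁ y₂ y₃ X₁ Y₂ →
               (((x₁ :* x₂) :* x₃) :* X₁) :* (((y₁ :* y₂) :* y₃) :* Y₂)
               := ((X₁ :* x₁) :* y₁ :* (x₂ :* (Y₂ :* y₂))) :* (x₃ :* y₃)) refl
               (x ^ e₁) (x ^ e₂) (x ^ o) (y ^ e₁) (y ^ e₂) (y ^ o) (X ^ e₁) (Y ^ e₂) ⟩
        ((X ^ e₁ * x ^ e₁) * y ^ e₁ * (x ^ e₂ * (Y ^ e₂ * y ^ e₂))) * (x ^ o * y ^ o)
          ≈⟨ sym (*-cong (*-cong (^-distrib-*₃ X x y e₁) (trans (^-distrib-* x (Y * y) e₂) (*-congˡ (^-distrib-* Y y e₂))))
                         (^-distrib-* x y o)) ⟩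
        ((X * x * y) ^ e₁ * (x * (Y * y)) ^ e₂) * (x * y) ^ o
          ≈⟨ *-congʳ (*-cong (^-congˡ e₁ (*-congʳ (sym (f-suc a)))) (^-congˡ e₂ (*-congˡ (sym (f-suc b))))) ⟩
        ((f (suc a) * y) ^ e₁ * (x * f (suc b)) ^ e₂) * (x * y) ^ o ∎
      merge : block f L (e₁ ℕ.+ e₂ ℕ.+ o) (a ℕ.+ b) (e₁ ℕ.+ e₂)
            ≈ (f (suc (a ℕ.+ b)) ^ e₁ * f (suc (a ℕ.+ b)) ^ e₂) * z ^ o
      merge = begin
        z ^ (e₁ ℕ.+ e₂ ℕ.+ o) * Z ^ (e₁ ℕ.+ e₂)
          ≈⟨ *-cong (^-homo-*₃ z e₁ e₂ o) (^-homo-* Z e₁ e₂) ⟩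
        ((z ^ e₁ * z ^ e₂) * z ^ o) * (Z ^ e₁ * Z ^ e₂)
          ≈⟨ solve 5 (λ z₁ z₂ z₃ Z₁ Z₂ → ((z₁ :* z₂) :* z₃) :* (Z₁ :* Z₂)
                                        := ((Z₁ :* z₁) :* (Z₂ :* z₂)) :* z₃) refl
               (z ^ e₁) (z ^ e₂) (z ^ o) (Z ^ e₁) (Z ^ e₂) ⟩
        ((Z ^ e₁ * z ^ e₁) * (Z ^ e₂ * z ^ e₂)) * z ^ o
          ≈⟨ *-congʳ (sym (*-cong (trans (^-congˡ e₁ (f-suc (a ℕ.+ b))) (^-distrib-* Z z e₁))
                                  (trans (^-congˡ e₂ (f-suc (a ℕ.+ b))) (^-distrib-* Z z e₂)))) ⟩
        (f (suc (a ℕ.+ b)) ^ e₁ * f (suc (a ℕ.+ b)) ^ e₂) * z ^ o ∎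

open import Data.Nat using (_+_; _*_)

ε≤ : ∀ k n → ε (suc k) n ≤ suc k
ε≤ k zero    = ℕₚ.≤-refl
ε≤ k (suc n) = m%n<n n (suc k)

suc≡/*+ε : ∀ k n → suc n ≡ n / suc k * suc k + ε (suc k) (suc n)
suc≡/*+ε k n = begin
  suc n                               ≡⟨ ≡.cong suc (m≡m%n+[m/n]*n n (suc k)) ⟩
  suc (n % suc k + n / suc k * suc k) ≡⟨ ≡.cong suc (ℕₚ.+-comm (n % suc k) _) ⟩
  suc (n / suc k * suc k + n % suc k) ≡⟨ ≡.sym (ℕₚ.+-suc (n / suc k * suc k) _) ⟩
  n / suc k * suc k + suc (n % suc k) ∎
  where open ≡.≡-Reasoning

ε-suc-*+ : ∀ k q {t} → t < suc k → ε (suc k) (suc (q * suc k + t)) ≡ suc t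
ε-suc-*+ k q {t} t<r = ≡.cong suc (≡.trans (%-remove-+ˡ t (n∣m*n q)) (m<n⇒m%n≡m t<r))

ceilDiv-suc-*+ : ∀ k q {t} → t < suc k → ceilDiv (suc k) (suc (q * suc k + t)) ≡ suc q
ceilDiv-suc-*+ k q {t} t<r = begin
  (suc (q * suc k + t) + k) / suc k    ≡⟨ /-congˡ (rearrange k q t) ⟩
  (t + suc q * suc k) / suc k          ≡⟨ +-distrib-/-∣ʳ t (n∣m*n (suc q)) ⟩
  t / suc k + suc q * suc k / suc k    ≡⟨ ≡.cong₂ _+_ (m<n⇒m/n≡0 t<r) (m*n/n≡m (suc q) (suc k)) ⟩
  suc q                                ∎
  where
  open ≡.≡-Reasoning
  rearrange : ∀ k q t → suc (q * suc k + t) + k ≡ t + suc q * suc k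
  rearrange = solve-∀

rlucas-suc-*+ : ∀ k R q {t} → t < suc k →
  rlucas (suc k ∷ R) (suc (q * suc k + t)) ≡ rlucas R (suc t) ⊗ φ (suc k) (lucas (suc q))
rlucas-suc-*+ k R q t<r =
  ≡.cong₂ (λ e c → rlucas R e ⊗ φ (suc k) (lucas c)) (ε-suc-*+ k q t<r) (ceilDiv-suc-*+ k q t<r)

⟦subst⟧ : ∀ σ e R ρ → ⟦ subst σ e ⟧ R ρ ≡ ⟦ e ⟧ R (λ i → ⟦ σ i ⟧ R ρ)
⟦subst⟧ σ (var i) R ρ = ≡.refl
⟦subst⟧ σ zer     R ρ = ≡.refl
⟦subst⟧ σ one     R ρ = ≡.refl
⟦subst⟧ σ (e ⊕ f) R ρ = ≡.cong₂ (CommutativeRing._+_ R) (⟦subst⟧ σ e R ρ) (⟦subst⟧ σ f R ρ)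
⟦subst⟧ σ (e ⊗ f) R ρ = ≡.cong₂ (CommutativeRing._*_ R) (⟦subst⟧ σ e R ρ) (⟦subst⟧ σ f R ρ)
⟦subst⟧ σ (⊝ e)   R ρ = ≡.cong (CommutativeRing.-_ R) (⟦subst⟧ σ e R ρ)

private module CR = CommutativeRing

-- A record around _≈P_: as a bare Π-type it would block inference of the implicit
-- arguments of every ring and divisibility lemma used below.
record _≋_ (e f : Expr) : Set₁ where
  constructor evaluation
  field ≋⇒≈P : e ≈P f
open _≋_

ℤ[S] : CommutativeRing 0ℓ (lsuc 0ℓ)
ℤ[S] = record
  { Carrier = Expr ; _≈_ = _≋_ ; _+_ = _⊕_ ; _*_ = _⊗_ ; -_ = ⊝_ ; 0# = zer ; 1# = one
  ; isCommutativeRing = record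
    { isRing = record
      { +-isAbelianGroup = record
        { isGroup = record
          { isMonoid = record
            { isSemigroup = record
              { isMagma = record
                { isEquivalence = record
                  { refl = evaluation λ R ρ → CR.refl R
                  ; sym = λ p → evaluation λ R ρ → CR.sym R (≋⇒≈P p R ρ)
                  ; trans = λ p q → evaluation λ R ρ → CR.trans R (≋⇒≈P p R ρ) (≋⇒≈P q R ρ) }
                ; ∙-cong = λ p q → evaluation λ R ρ → CR.+-cong R (≋⇒≈P p R ρ) (≋⇒≈P q R ρ) }
              ; assoc = λ x y z → evaluation λ R ρ → CR.+-assoc R _ _ _ }
            ; identity = (λ x → evaluation λ R ρ → CR.+-identityˡ R _)
                       , (λ x → evaluation λ R ρ → CR.+-identityʳ R _) }
          ; inverse = (λ x → evaluation λ R ρ → CR.-‿inverseˡ R _)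
                    , (λ x → evaluation λ R ρ → CR.-‿inverseʳ R _)
          ; ⁻¹-cong = λ p → evaluation λ R ρ → CR.-‿cong R (≋⇒≈P p R ρ) }
        ; comm = λ x y → evaluation λ R ρ → CR.+-comm R _ _ }
      ; *-cong = λ p q → evaluation λ R ρ → CR.*-cong R (≋⇒≈P p R ρ) (≋⇒≈P q R ρ)
      ; *-assoc = λ x y z → evaluation λ R ρ → CR.*-assoc R _ _ _
      ; *-identity = (λ x → evaluation λ R ρ → CR.*-identityˡ R _)
                   , (λ x → evaluation λ R ρ → CR.*-identityʳ R _)
      ; distrib = (λ x y z → evaluation λ R ρ → CR.distribˡ R _ _ _)
                , (λ x y z → evaluation λ R ρ → CR.distribʳ R _ _ _) }
    ; *-comm = λ x y → evaluation λ R ρ → CR.*-comm R _ _ } }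

open CommutativeRing ℤ[S]
  using ( _≈_; refl; sym; trans; reflexive; setoid; commutativeSemiring; *-commutativeSemigroup
        ; +-cong; +-identityʳ; *-assoc; *-cong; *-congˡ; *-congʳ; *-identityˡ; *-identityʳ; zeroˡ; zeroʳ)
open import Algebra.Properties.CommutativeSemiring.Exp commutativeSemiring using (_^_; ^-homo-*; ^-distrib-*)
open import Algebra.Properties.Semiring.Divisibility (CommutativeRing.semiring ℤ[S])
  using (_∣_; _,_; ∣ʳ-reflexive; ∣ʳ-respˡ-≈; ∣ʳ-respʳ-≈; x∣ʳy⇒x∣ʳzy)
open import Algebra.Properties.CommutativeSemigroup.Divisibility *-commutativeSemigroup
  using (∙-cong-∣; x∣y⇒zx∣zy)
open import Algebra.Properties.CommutativeSemigroup *-commutativeSemigroup using (x∙yz≈y∙xz)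
open import Algebra.Solver.Ring.NaturalCoefficients.Default commutativeSemiring using (solve; _:=_; _:+_; _:*_)
open import Relation.Binary.Reasoning.Setoid setoid
open CommutativeSemiringDivisibility commutativeSemiring
  using (1^n≈1; x∣y∧x∣z⇒x∣y+z; x^n∣x^[m+n]; block; block*block∣block)

subst-cong : ∀ σ {e f} → e ≈ f → subst σ e ≈ subst σ f
subst-cong σ {e} {f} e≋f = evaluation λ R ρ →
  ≡.subst₂ (CR._≈_ R) (≡.sym (⟦subst⟧ σ e R ρ)) (≡.sym (⟦subst⟧ σ f R ρ)) (≋⇒≈P e≋f R (λ i → ⟦ σ i ⟧ R ρ))

subst-∣ : ∀ σ {e f} → e ∣ f → subst σ e ∣ subst σ f
subst-∣ σ (q , q*e≈f) = subst σ q , subst-cong σ q*e≈f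

^P≡^ : ∀ e n → e ^P n ≡ e ^ n
^P≡^ e zero    = ≡.refl
^P≡^ e (suc n) = ≡.cong (e ⊗_) (^P≡^ e n)

lucas-+ : ∀ a b → lucas (a + suc b) ≈ lucas (suc a) ⊗ lucas (suc b) ⊕ s 2 ⊗ (lucas a ⊗ lucas b)
lucas-+ zero b = sym (trans (+-cong (*-identityˡ _) (trans (*-congˡ (zeroˡ _)) (zeroʳ _))) (+-identityʳ _))
lucas-+ (suc zero) b =
  sym (+-cong (*-congʳ (trans (+-cong (*-identityʳ _) (zeroʳ _)) (+-identityʳ _))) (*-congˡ (*-identityˡ _)))
lucas-+ (suc (suc a)) b = begin
  s 1 ⊗ lucas (suc a + suc b) ⊕ s 2 ⊗ lucas (a + suc b)
    ≈⟨ +-cong (*-congˡ (lucas-+ (suc a) b)) (*-congˡ (lucas-+ a b)) ⟩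
  s 1 ⊗ (L₂ ⊗ L₁′ ⊕ s 2 ⊗ (L₁ ⊗ L₀′)) ⊕ s 2 ⊗ (L₁ ⊗ L₁′ ⊕ s 2 ⊗ (L₀ ⊗ L₀′))
    -- L₂ = lucas (2 + a) unfolds to s₁ L₁ + s₂ L₀, so the recurrence enters through the solver input.
    ≈⟨ solve 6 (λ s₁ s₂ L₀ L₁ L₀′ L₁′ →
         let L₂ = s₁ :* L₁ :+ s₂ :* L₀ in
         s₁ :* (L₂ :* L₁′ :+ s₂ :* (L₁ :* L₀′)) :+ s₂ :* (L₁ :* L₁′ :+ s₂ :* (L₀ :* L₀′))
         := (s₁ :* L₂ :+ s₂ :* L₁) :* L₁′ :+ s₂ :* (L₂ :* L₀′)) refl
         (s 1) (s 2) L₀ L₁ L₀′ L₁′ ⟩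
  (s 1 ⊗ L₂ ⊕ s 2 ⊗ L₁) ⊗ L₁′ ⊕ s 2 ⊗ (L₂ ⊗ L₀′) ∎
  where
  L₀ = lucas a ; L₁ = lucas (suc a) ; L₂ = lucas (suc (suc a)) ; L₀′ = lucas b ; L₁′ = lucas (suc b)

lucas! : ℕ → Expr
lucas! zero    = one
lucas! (suc n) = lucas (suc n) ⊗ lucas! n

lucas!*lucas!∣lucas! : ∀ a b → lucas! a ⊗ lucas! b ∣ lucas! (a + b)
lucas!*lucas!∣lucas! zero    b    = ∣ʳ-reflexive (*-identityˡ (lucas! b))
lucas!*lucas!∣lucas! (suc a) zero =
  ∣ʳ-reflexive (trans (*-identityʳ (lucas! (suc a))) (reflexive (≡.cong lucas! (≡.sym (ℕₚ.+-identityʳ (suc a))))))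
lucas!*lucas!∣lucas! (suc a) (suc b) =
  ∣ʳ-respʳ-≈ (sym expand) (x∣y∧x∣z⇒x∣y+z (x∣ʳy⇒x∣ʳzy _ shift-b) (x∣ʳy⇒x∣ʳzy _ shift-a))
  where
  F = lucas! (a + suc b)
  shift-b : lucas! (suc a) ⊗ lucas! (suc b) ∣ lucas (suc b) ⊗ F
  shift-b = ∣ʳ-respˡ-≈ (x∙yz≈y∙xz (lucas (suc b)) (lucas! (suc a)) (lucas! b))
    (∣ʳ-respʳ-≈ (reflexive (≡.cong (λ n → lucas (suc b) ⊗ lucas! n) (≡.sym (ℕₚ.+-suc a b))))
      (x∣y⇒zx∣zy (lucas (suc b)) (lucas!*lucas!∣lucas! (suc a) b)))
  shift-a : lucas! (suc a) ⊗ lucas! (suc b) ∣ lucas (suc a) ⊗ F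
  shift-a = ∣ʳ-respˡ-≈ (sym (*-assoc (lucas (suc a)) (lucas! a) (lucas! (suc b))))
    (x∣y⇒zx∣zy (lucas (suc a)) (lucas!*lucas!∣lucas! a (suc b)))
  expand : lucas! (suc a + suc b)
         ≈ lucas (suc (suc a)) ⊗ (lucas (suc b) ⊗ F) ⊕ s 2 ⊗ lucas b ⊗ (lucas (suc a) ⊗ F)
  expand = begin
    lucas (suc a + suc b) ⊗ F
      ≈⟨ *-congʳ (lucas-+ (suc a) b) ⟩
    (lucas (suc (suc a)) ⊗ lucas (suc b) ⊕ s 2 ⊗ (lucas (suc a) ⊗ lucas b)) ⊗ F
      ≈⟨ solve 6 (λ L₂ L₁′ s₂ L₁ L₀′ F → (L₂ :* L₁′ :+ s₂ :* (L₁ :* L₀′)) :* F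
                                        := L₂ :* (L₁′ :* F) :+ s₂ :* L₀′ :* (L₁ :* F)) refl
           (lucas (suc (suc a))) (lucas (suc b)) (s 2) (lucas (suc a)) (lucas b) F ⟩
    lucas (suc (suc a)) ⊗ (lucas (suc b) ⊗ F) ⊕ s 2 ⊗ lucas b ⊗ (lucas (suc a) ⊗ F) ∎

rfact*rfact0∣rfact : ∀ R α → rfact R α ⊗ rfact R 0 ∣ rfact R (α + 0)
rfact*rfact0∣rfact R α =
  ∣ʳ-reflexive (trans (*-identityʳ (rfact R α)) (reflexive (≡.cong (rfact R) (≡.sym (ℕₚ.+-identityʳ α)))))

rfact[]*rfact[]∣rfact[] : ∀ α β → rfact [] α ⊗ rfact [] β ∣ rfact [] (α + β)
rfact[]*rfact[]∣rfact[] α zero    = rfact*rfact0∣rfact [] α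
rfact[]*rfact[]∣rfact[] α (suc β) =
  ∣ʳ-respˡ-≈ (x∙yz≈y∙xz (s 1 ^P β) (rfact [] α) (rfact [] β))
    (∣ʳ-respʳ-≈ (reflexive (≡.cong (rfact []) (≡.sym (ℕₚ.+-suc α β))))
      (∙-cong-∣ s₁^β∣s₁^[α+β] (rfact[]*rfact[]∣rfact[] α β)))
  where
  s₁^β∣s₁^[α+β] : s 1 ^P β ∣ s 1 ^P (α + β)
  s₁^β∣s₁^[α+β] = ≡.subst₂ _∣_ (≡.sym (^P≡^ (s 1) β)) (≡.sym (^P≡^ (s 1) (α + β))) (x^n∣x^[m+n] (s 1) α β)

φ-∣ : ∀ r {e f} → e ∣ f → φ r e ∣ φ r f
φ-∣ r = subst-∣ _

lucasBlock : ℕ → ℕ → ℕ → Expr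
lucasBlock r = block (λ n → φ r (lucas! n)) (λ n → φ r (lucas n)) r

lucasBlock*lucasBlock∣lucasBlock : ∀ {r a b e₁ e₂} → e₁ + e₂ ≤ r →
  lucasBlock r a e₁ ⊗ lucasBlock r b e₂ ∣ lucasBlock r (a + b) (e₁ + e₂)
lucasBlock*lucasBlock∣lucasBlock {r} {a} {b} {e₁} {e₂} =
  block*block∣block (λ n → φ r (lucas! n)) (λ n → φ r (lucas n)) (λ _ → refl)
    (λ a b → φ-∣ r (lucas!*lucas!∣lucas! a b)) {r} {a} {b} {e₁} {e₂}

rfact-*+ : ∀ k R q t → t ≤ suc k →
  rfact (suc k ∷ R) (q * suc k + t) ≈ (rfact R t ⊗ φ (suc k) (lucas (suc q)) ^ t) ⊗ rfact (suc k ∷ R) (q * suc k)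
rfact-*+ k R q zero _ = begin
  rfact (suc k ∷ R) (q * suc k + 0) ≡⟨ ≡.cong (rfact (suc k ∷ R)) (ℕₚ.+-identityʳ (q * suc k)) ⟩
  rfact (suc k ∷ R) (q * suc k)     ≈⟨ sym (trans (*-congʳ (*-identityˡ one)) (*-identityˡ _)) ⟩
  (one ⊗ one) ⊗ rfact (suc k ∷ R) (q * suc k) ∎
rfact-*+ k R q (suc t) t<r = begin
  rfact (suc k ∷ R) (q * suc k + suc t)
    ≡⟨ ≡.cong (rfact (suc k ∷ R)) (ℕₚ.+-suc (q * suc k) t) ⟩
  rlucas (suc k ∷ R) (suc (q * suc k + t)) ⊗ rfact (suc k ∷ R) (q * suc k + t)
    ≡⟨ ≡.cong (_⊗ rfact (suc k ∷ R) (q * suc k + t)) (rlucas-suc-*+ k R q t<r) ⟩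
  (rlucas R (suc t) ⊗ Λ) ⊗ rfact (suc k ∷ R) (q * suc k + t)
    ≈⟨ *-congˡ (rfact-*+ k R q t (ℕₚ.<⇒≤ t<r)) ⟩
  (rlucas R (suc t) ⊗ Λ) ⊗ ((rfact R t ⊗ Λ ^ t) ⊗ B)
    ≈⟨ solve 5 (λ g Λ f Λᵗ B → (g :* Λ) :* ((f :* Λᵗ) :* B) := ((g :* f) :* (Λ :* Λᵗ)) :* B) refl
         (rlucas R (suc t)) Λ (rfact R t) (Λ ^ t) B ⟩
  (rfact R (suc t) ⊗ Λ ^ suc t) ⊗ B ∎
  where
  Λ = φ (suc k) (lucas (suc q))
  B = rfact (suc k ∷ R) (q * suc k)

rfact-* : ∀ k R q → rfact (suc k ∷ R) (q * suc k) ≈ rfact R (suc k) ^ q ⊗ φ (suc k) (lucas! q) ^ suc k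
rfact-* k R zero    = sym (trans (*-identityˡ _) (1^n≈1 (suc k)))
rfact-* k R (suc q) = begin
  rfact (suc k ∷ R) (suc q * suc k)
    ≡⟨ ≡.cong (rfact (suc k ∷ R)) (ℕₚ.+-comm (suc k) (q * suc k)) ⟩
  rfact (suc k ∷ R) (q * suc k + suc k)
    ≈⟨ rfact-*+ k R q (suc k) ℕₚ.≤-refl ⟩
  (F ⊗ Λ ^ suc k) ⊗ rfact (suc k ∷ R) (q * suc k)
    ≈⟨ *-congˡ (rfact-* k R q) ⟩
  (F ⊗ Λ ^ suc k) ⊗ (F ^ q ⊗ ℓ ^ suc k)
    ≈⟨ solve 4 (λ F Λʳ Fᵍ ℓʳ → (F :* Λʳ) :* (Fᵍ :* ℓʳ) := (F :* Fᵍ) :* (Λʳ :* ℓʳ)) refl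
         F (Λ ^ suc k) (F ^ q) (ℓ ^ suc k) ⟩
  F ^ suc q ⊗ (Λ ^ suc k ⊗ ℓ ^ suc k)
    ≈⟨ *-congˡ (sym (^-distrib-* Λ ℓ (suc k))) ⟩
  F ^ suc q ⊗ φ (suc k) (lucas! (suc q)) ^ suc k ∎
  where
  F = rfact R (suc k)
  Λ = φ (suc k) (lucas (suc q))
  ℓ = φ (suc k) (lucas! q)

rfact-block : ∀ k R q t → t ≤ suc k →
  rfact (suc k ∷ R) (q * suc k + t) ≈ (rfact R t ⊗ rfact R (suc k) ^ q) ⊗ lucasBlock (suc k) q t
rfact-block k R q t t≤r = begin
  rfact (suc k ∷ R) (q * suc k + t)
    ≈⟨ trans (rfact-*+ k R q t t≤r) (*-congˡ (rfact-* k R q)) ⟩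
  (rfact R t ⊗ Λ ^ t) ⊗ (F ^ q ⊗ ℓ ^ suc k)
    ≈⟨ solve 4 (λ f Λᵗ Fᵍ ℓʳ → (f :* Λᵗ) :* (Fᵍ :* ℓʳ) := (f :* Fᵍ) :* (ℓʳ :* Λᵗ)) refl
         (rfact R t) (Λ ^ t) (F ^ q) (ℓ ^ suc k) ⟩
  (rfact R t ⊗ F ^ q) ⊗ lucasBlock (suc k) q t ∎
  where
  F = rfact R (suc k)
  Λ = φ (suc k) (lucas (suc q))
  ℓ = φ (suc k) (lucas! q)

rfact*rfact∣rfact-step : ∀ k R a b {e₁ e₂} → e₁ + e₂ ≤ suc k → rfact R e₁ ⊗ rfact R e₂ ∣ rfact R (e₁ + e₂) →
  rfact (suc k ∷ R) (a * suc k + e₁) ⊗ rfact (suc k ∷ R) (b * suc k + e₂)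
    ∣ rfact (suc k ∷ R) ((a * suc k + e₁) + (b * suc k + e₂))
rfact*rfact∣rfact-step k R a b {e₁} {e₂} e₁+e₂≤r IH =
  ∣ʳ-respˡ-≈ (sym split) (∣ʳ-respʳ-≈ (sym merge)
    (∙-cong-∣ (∙-cong-∣ IH (∣ʳ-reflexive (sym (^-homo-* F a b))))
              (lucasBlock*lucasBlock∣lucasBlock {suc k} {a} {b} {e₁} {e₂} e₁+e₂≤r)))
  where
  F = rfact R (suc k)
  split : rfact (suc k ∷ R) (a * suc k + e₁) ⊗ rfact (suc k ∷ R) (b * suc k + e₂)
        ≈ ((rfact R e₁ ⊗ rfact R e₂) ⊗ (F ^ a ⊗ F ^ b)) ⊗ (lucasBlock (suc k) a e₁ ⊗ lucasBlock (suc k) b e₂)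
  split = begin
    rfact (suc k ∷ R) (a * suc k + e₁) ⊗ rfact (suc k ∷ R) (b * suc k + e₂)
      ≈⟨ *-cong (rfact-block k R a e₁ (ℕₚ.m+n≤o⇒m≤o e₁ e₁+e₂≤r)) (rfact-block k R b e₂ (ℕₚ.m+n≤o⇒n≤o e₁ e₁+e₂≤r)) ⟩
    ((rfact R e₁ ⊗ F ^ a) ⊗ lucasBlock (suc k) a e₁) ⊗ ((rfact R e₂ ⊗ F ^ b) ⊗ lucasBlock (suc k) b e₂)
      ≈⟨ solve 6 (λ f₁ Fᵃ Λ₁ f₂ Fᵇ Λ₂ → ((f₁ :* Fᵃ) :* Λ₁) :* ((f₂ :* Fᵇ) :* Λ₂)
                                       := ((f₁ :* f₂) :* (Fᵃ :* Fᵇ)) :* (Λ₁ :* Λ₂)) refl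
           (rfact R e₁) (F ^ a) (lucasBlock (suc k) a e₁) (rfact R e₂) (F ^ b) (lucasBlock (suc k) b e₂) ⟩
    ((rfact R e₁ ⊗ rfact R e₂) ⊗ (F ^ a ⊗ F ^ b)) ⊗ (lucasBlock (suc k) a e₁ ⊗ lucasBlock (suc k) b e₂) ∎
  merge : rfact (suc k ∷ R) ((a * suc k + e₁) + (b * suc k + e₂))
        ≈ (rfact R (e₁ + e₂) ⊗ F ^ (a + b)) ⊗ lucasBlock (suc k) (a + b) (e₁ + e₂)
  merge = trans (reflexive (≡.cong (rfact (suc k ∷ R)) (regroup a b (suc k) e₁ e₂)))
                (rfact-block k R (a + b) (e₁ + e₂) e₁+e₂≤r)
    where
    regroup : ∀ a b r e₁ e₂ → (a * r + e₁) + (b * r + e₂) ≡ (a + b) * r + (e₁ + e₂)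
    regroup = solve-∀

Cond-head : ∀ R {ν α β} → Cond R ν α β → ν ≡ α + β
Cond-head []      ν≡α+β       = ν≡α+β
Cond-head (r ∷ R) (ν≡α+β , _) = ν≡α+β

rfact*rfact∣rfact : ∀ R → All (0 <_) R → ∀ α β → Cond R (α + β) α β →
  rfact R α ⊗ rfact R β ∣ rfact R (α + β)
rfact*rfact∣rfact []            _         α       β        _        = rfact[]*rfact[]∣rfact[] α β
rfact*rfact∣rfact (r ∷ R)       _         zero    β        _        = ∣ʳ-reflexive (*-identityˡ (rfact (r ∷ R) β))
rfact*rfact∣rfact (r ∷ R)       _         (suc j) zero     _        = rfact*rfact0∣rfact (r ∷ R) (suc j)
rfact*rfact∣rfact (suc k ∷ R)   (_ ∷ pos) (suc j) (suc j′) (_ , cond) =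
  ≡.subst₂ (λ α β → rfact (suc k ∷ R) α ⊗ rfact (suc k ∷ R) β ∣ rfact (suc k ∷ R) (α + β))
    (≡.sym (suc≡/*+ε k j)) (≡.sym (suc≡/*+ε k j′))
    (rfact*rfact∣rfact-step k R (j / suc k) (j′ / suc k) e₁+e₂≤r
      (rfact*rfact∣rfact R pos e₁ e₂ (≡.subst (λ ν → Cond R ν e₁ e₂) ε≡e₁+e₂ cond)))
  where
  e₁ = ε (suc k) (suc j)
  e₂ = ε (suc k) (suc j′)
  ε≡e₁+e₂ : ε (suc k) (suc j + suc j′) ≡ e₁ + e₂
  ε≡e₁+e₂ = Cond-head R cond
  e₁+e₂≤r : e₁ + e₂ ≤ suc k
  e₁+e₂≤r = ≡.subst (_≤ suc k) ε≡e₁+e₂ (ε≤ k (suc j + suc j′))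

∣⇒∣P : ∀ {e f} → e ∣ f → e ∣P f
∣⇒∣P (q , q*e≋f) = q , ≋⇒≈P q*e≋f

rfact[n]*rfact[m∸n]∣rfact[m] : ∀ R → All (0 <_) R → ∀ m n → n ≤ m → Cond R m n (m ∸ n) →
  rfact R n ⊗ rfact R (m ∸ n) ∣ rfact R m
rfact[n]*rfact[m∸n]∣rfact[m] R pos m n n≤m cond =
  ≡.subst (λ ν → rfact R n ⊗ rfact R (m ∸ n) ∣ rfact R ν) n+[m∸n]≡m
    (rfact*rfact∣rfact R pos n (m ∸ n) (≡.subst (λ ν → Cond R ν n (m ∸ n)) (≡.sym n+[m∸n]≡m) cond))
  where
  n+[m∸n]≡m : n + (m ∸ n) ≡ m
  n+[m∸n]≡m = ℕₚ.m+[n∸m]≡n n≤m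

theorem7p3 : (r₁ : ℕ) (R′ : List ℕ) → DecreasingPos (r₁ ∷ R′) →
    (m n : ℕ) → n ≤ m → Cond (r₁ ∷ R′) m n (m ∸ n) →
    (rfact (r₁ ∷ R′) n ⊗ rfact (r₁ ∷ R′) (m ∸ n)) ∣P rfact (r₁ ∷ R′) m
theorem7p3 r₁ R′ (_ , pos) m n n≤m cond = ∣⇒∣P (rfact[n]*rfact[m∸n]∣rfact[m] (r₁ ∷ R′) pos m n n≤m cond)
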